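{- For integers $n\ge 0$ and $k$, define $$h(n,k)=\sum_{j\in\mathbb{Z}} q^{2j^2-j}\begin{bmatrix} \lfloor n/2\rfloor\\ k+j\end{bmatrix}_{q^2}\begin{bmatrix} \lceil n/2\rceil\\ k+1-j\end{bmatrix}_{q^2}.$$ Then $h(n,k)=\begin{bmatrix} n\\ 2k+1\end{bmatrix}_q$ for all $n\ge 0$ and all $k$.
   Context: $q$ is an indeterminate. For a base $p$ (here $p=q$ or $p=q^2$) and integers $n,k$, $\begin{bmatrix} n\\ k\end{bmatrix}_p$ denotes the Gaussian binomial coefficient $\frac{(p;p)_n}{(p;p)_k(p;p)_{n-k}}$ for $0\le k\le n$ and $0$ otherwise, where $(x;p)_m=(1-x)(1-xp)\cdots(1-xp^{m-1})$. -}

module Defs where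

open import Level using (Level)
open import Algebra.Bundles using (CommutativeRing)
open import Data.Nat as ℕ using (ℕ; zero; suc; ⌊_/2⌋; ⌈_/2⌉)
open import Data.Integer as ℤ using (ℤ; +_; -[1+_]; ∣_∣)
open import Data.List using (List; map; upTo; foldr)

-- Everything is stated in an arbitrary commutative ring R at an arbitrary
-- element q; holding for all (R, q) is equivalent to the identity in ℤ[q].
module Gauss {c ℓ : Level} (R : CommutativeRing c ℓ) where
  open CommutativeRing R

  pow : Carrier → ℕ → Carrier
  pow x zero    = 1#
  pow x (suc m) = x * pow x m

  gaussℕ : Carrier → ℕ → ℕ → Carrier
  gaussℕ p zero    zero    = 1#
  gaussℕ p zero    (suc k) = 0#
  gaussℕ p (suc n) zero    = 1#
  gaussℕ p (suc n) (suc k) = gaussℕ p n k + pow p (suc k) * gaussℕ p n (suc k)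

  -- Gaussian binomial with integer lower index (0 for negative k;
  -- for k > n the recursion already gives 0)
  gauss : Carrier → ℕ → ℤ → Carrier
  gauss p n (+ k)    = gaussℕ p n k
  gauss p n -[1+ k ] = 0#

  sumL : List Carrier → Carrier
  sumL = foldr _+_ 0#

  -- an integer window [-M, M] with M = n + |k| + 1, which contains the
  -- whole (finite) support of the summand over j ∈ ℤ
  window : ℕ → ℤ → List ℤ
  window n k = map (λ i → + i ℤ.- + M) (upTo (suc (2 ℕ.* M)))
    where M = n ℕ.+ ∣ k ∣ ℕ.+ 1

  -- the summand q^(2j²-j) [⌊n/2⌋, k+j]_{q²} [⌈n/2⌉, k+1-j]_{q²}
  -- (2j²-j = j(2j-1) ≥ 0 for every integer j, so ∣_∣ is harmless)
  term : Carrier → ℕ → ℤ → ℤ → Carrier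
  term q n k j =
    pow q ∣ + 2 ℤ.* j ℤ.* j ℤ.- j ∣
      * (gauss (q * q) ⌊ n /2⌋ (k ℤ.+ j)
      * gauss (q * q) ⌈ n /2⌉ (k ℤ.+ + 1 ℤ.- j))

  h : Carrier → ℕ → ℤ → Carrier
  h q n k = sumL (map (term q n k) (window n k))

{-# OPTIONS --safe #-}
-- Alongside h(n,k) consider the companion sum
-- Σ_j q^(2j²-j) [⌊n/2⌋, k-j]_{q²} [⌈n/2⌉, k+j]_{q²}, which equals [n, 2k]_q.  As
-- ⌊(n+1)/2⌋ = ⌈n/2⌉ and ⌈(n+1)/2⌉ = ⌊n/2⌋ + 1, Pascal's rule in base q² for the second
-- factor splits a summand for n + 1 into a summand of the other parity plus q^m times a
-- summand for n at the reflected index 1 - j (resp. -j), where m = 2k+1 (resp. 2k); the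
-- powers of q match since 2j²-j + 2(k+1-j) = (2k+1) + (2(1-j)² - (1-j)).  Summed over j,
-- both sums thus obey the q-Pascal recursion [n+1, m]_q = [n, m-1]_q + q^m [n, m]_q, and
-- induction on n proves both identities at once.  Sums over ℤ are taken over a window
-- [-M, M] containing the support, which makes the reindexings j ↦ -j and j ↦ 1 - j exact.
module Submission where

open import Defs
open import Level using (Level)
open import Algebra.Bundles using (CommutativeRing)
import Algebra.Properties.CommutativeSemigroup as CommutativeSemigroupProperties
open import Data.Nat as ℕ using (ℕ; zero; suc; z≤n; ⌊_/2⌋; ⌈_/2⌉)
import Data.Nat.Properties as ℕP
open import Data.Integer as ℤ using (ℤ; +_; -[1+_]; +[1+_]; ∣_∣; 0ℤ; +≤+)
import Data.Integer.Properties as ℤP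
open import Data.Integer.Tactic.RingSolver using (solve-∀)
open import Data.List using (map; upTo; applyUpTo)
open import Data.List.Properties using (map-upTo; map-applyUpTo)
open import Data.Product using (_×_; _,_)
open import Function using (_∘_)
open import Relation.Nullary using (¬_)
open import Relation.Binary.PropositionalEquality as ≡ using (_≡_; _≢_)

-- For j = -[1+ m ] and for the factorisation (1 + m)(1 + 2m) the integer
-- normalises to a +_ constructor, so nonnegativity holds by computation.
0≤2j²-j : ∀ j → 0ℤ ℤ.≤ + 2 ℤ.* j ℤ.* j ℤ.- j
0≤2j²-j -[1+ m ] = +≤+ z≤n
0≤2j²-j (+ zero) = +≤+ z≤n
0≤2j²-j +[1+ m ] = ≡.subst (0ℤ ℤ.≤_) (≡.sym (factorise (+ m))) (+≤+ z≤n)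
  where
  factorise : ∀ x → + 2 ℤ.* (+ 1 ℤ.+ x) ℤ.* (+ 1 ℤ.+ x) ℤ.- (+ 1 ℤ.+ x)
                      ≡ (+ 1 ℤ.+ x) ℤ.* (+ 1 ℤ.+ (x ℤ.+ x))
  factorise = solve-∀

2k+1≢0 : ∀ k → + 2 ℤ.* k ℤ.+ + 1 ≢ 0ℤ
2k+1≢0 (+ zero)       ()
2k+1≢0 +[1+ m ]       ()
2k+1≢0 -[1+ zero ]    ()
2k+1≢0 -[1+ suc m ]   ()

odd-indices-sum : ∀ k j → (k ℤ.+ j) ℤ.+ (k ℤ.+ + 1 ℤ.- j) ≡ + 2 ℤ.* k ℤ.+ + 1
odd-indices-sum = solve-∀

even-indices-sum : ∀ k j → (k ℤ.- j) ℤ.+ (k ℤ.+ j) ≡ + 2 ℤ.* k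
even-indices-sum = solve-∀

module _ {c ℓ : Level} (R : CommutativeRing c ℓ) where
  open CommutativeRing R
  open Gauss R
  open import Relation.Binary.Reasoning.Setoid setoid
  private
    module +-Props = CommutativeSemigroupProperties +-commutativeSemigroup
    module *-Props = CommutativeSemigroupProperties *-commutativeSemigroup

  *-vanishesʳ : ∀ {x y} → y ≈ 0# → x * y ≈ 0#
  *-vanishesʳ {x} y≈0 = trans (*-congˡ y≈0) (zeroʳ x)

  pow-+ : ∀ x m n → pow x (m ℕ.+ n) ≈ pow x m * pow x n
  pow-+ x zero    n = sym (*-identityˡ _)
  pow-+ x (suc m) n = trans (*-congˡ (pow-+ x m n)) (sym (*-assoc _ _ _))

  pow-square : ∀ x m → pow (x * x) m ≈ pow x (m ℕ.+ m)
  pow-square x zero    = refl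
  pow-square x (suc m) = begin
    (x * x) * pow (x * x) m    ≈⟨ *-congˡ (pow-square x m) ⟩
    (x * x) * pow x (m ℕ.+ m)  ≈⟨ *-assoc x x _ ⟩
    x * (x * pow x (m ℕ.+ m))  ≡⟨ ≡.cong (λ e → x * pow x e) (ℕP.+-suc m m) ⟨
    x * pow x (m ℕ.+ suc m)    ∎

  pow-balance : ∀ x {e e′ u v} → e ℕ.+ (u ℕ.+ u) ≡ (v ℕ.+ u) ℕ.+ e′ →
                pow x e * pow (x * x) u ≈ pow x (v ℕ.+ u) * pow x e′
  pow-balance x {e} {e′} {u} {v} balanced = begin
    pow x e * pow (x * x) u     ≈⟨ *-congˡ (pow-square x u) ⟩
    pow x e * pow x (u ℕ.+ u)   ≈⟨ pow-+ x e (u ℕ.+ u) ⟨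
    pow x (e ℕ.+ (u ℕ.+ u))     ≡⟨ ≡.cong (pow x) balanced ⟩
    pow x ((v ℕ.+ u) ℕ.+ e′)    ≈⟨ pow-+ x (v ℕ.+ u) e′ ⟩
    pow x (v ℕ.+ u) * pow x e′  ∎

  gaussℕ-above : ∀ p {m t} → m ℕ.< t → gaussℕ p m t ≈ 0#
  gaussℕ-above p {zero}  {suc t} _              = refl
  gaussℕ-above p {suc m} {suc t} (ℕ.s≤s m<t) = begin
    gaussℕ p m t + pow p (suc t) * gaussℕ p m (suc t)
      ≈⟨ +-cong (gaussℕ-above p m<t) (*-vanishesʳ (gaussℕ-above p (ℕP.m<n⇒m<1+n m<t))) ⟩
    0# + 0#  ≈⟨ +-identityˡ 0# ⟩
    0#       ∎

  gauss-outside : ∀ p m i → m ℕ.< ∣ i ∣ → gauss p m i ≈ 0#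
  gauss-outside p m (+ t)    m<t = gaussℕ-above p m<t
  gauss-outside p m -[1+ t ] _   = refl

  gauss-pascal : ∀ p m i → gauss p (suc m) i ≈ gauss p m (i ℤ.- + 1) + pow p ∣ i ∣ * gauss p m i
  gauss-pascal p zero    (+ zero) = sym (trans (+-identityˡ _) (*-identityˡ _))
  gauss-pascal p (suc m) (+ zero) = sym (trans (+-identityˡ _) (*-identityˡ _))
  gauss-pascal p m       +[1+ t ] = refl
  gauss-pascal p m       -[1+ t ] = sym (trans (+-identityˡ _) (zeroʳ _))

  weighted : Carrier → ℕ → ℕ → ℤ → ℤ → ℤ → Carrier
  weighted q a b e x y = pow q ∣ e ∣ * (gauss (q * q) a x * gauss (q * q) b y)

  weighted₀-vanishes : ∀ q e x y → ¬ (x ≡ 0ℤ × y ≡ 0ℤ) → weighted q 0 0 e x y ≈ 0#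
  weighted₀-vanishes q e -[1+ _ ] y        _   = *-vanishesʳ (zeroˡ _)
  weighted₀-vanishes q e +[1+ _ ] y        _   = *-vanishesʳ (zeroˡ _)
  weighted₀-vanishes q e (+ zero) -[1+ _ ] _   = *-vanishesʳ (zeroʳ _)
  weighted₀-vanishes q e (+ zero) +[1+ _ ] _   = *-vanishesʳ (zeroʳ _)
  weighted₀-vanishes q e (+ zero) (+ zero) ¬00 with () ← ¬00 (≡.refl , ≡.refl)

  pascal-weight-transfer : ∀ q a b {e e′} x y → 0ℤ ℤ.≤ e → 0ℤ ℤ.≤ e′ →
                           e ℤ.+ (y ℤ.+ y) ≡ (x ℤ.+ y) ℤ.+ e′ →
                           pow q ∣ e ∣ * (pow (q * q) ∣ y ∣ * (gauss (q * q) a y * gauss (q * q) b x))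
                             ≈ pow q ∣ x ℤ.+ y ∣ * weighted q a b e′ y x
  pascal-weight-transfer q a b x        -[1+ _ ] _ _ _ =
    trans (*-vanishesʳ (*-vanishesʳ (zeroˡ _))) (sym (*-vanishesʳ (*-vanishesʳ (zeroˡ _))))
  pascal-weight-transfer q a b -[1+ _ ] (+ u)    _ _ _ =
    trans (*-vanishesʳ (*-vanishesʳ (zeroʳ _))) (sym (*-vanishesʳ (*-vanishesʳ (zeroʳ _))))
  pascal-weight-transfer q a b {+ e} {+ e′} (+ v) (+ u) _ _ balanced = begin
    pow q e * (pow (q * q) u * P)
      ≈⟨ *-assoc _ _ _ ⟨
    (pow q e * pow (q * q) u) * P
      ≈⟨ *-congʳ (pow-balance q {e} {e′} {u} {v} (ℤP.+-injective balanced)) ⟩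
    (pow q (v ℕ.+ u) * pow q e′) * P
      ≈⟨ *-assoc _ _ _ ⟩
    pow q (v ℕ.+ u) * (pow q e′ * P) ∎
    where P = gauss (q * q) a (+ u) * gauss (q * q) b (+ v)

  weighted-pascal : ∀ q a b {e e′} x y → 0ℤ ℤ.≤ e → 0ℤ ℤ.≤ e′ →
                    e ℤ.+ (y ℤ.+ y) ≡ (x ℤ.+ y) ℤ.+ e′ →
                    weighted q b (suc a) e x y
                      ≈ weighted q a b e (y ℤ.- + 1) x + pow q ∣ x ℤ.+ y ∣ * weighted q a b e′ y x
  weighted-pascal q a b {e} {e′} x y 0≤e 0≤e′ balanced = begin
    pow q ∣ e ∣ * (G b x * G (suc a) y)
      ≈⟨ *-congˡ (*-congˡ (gauss-pascal (q * q) a y)) ⟩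
    pow q ∣ e ∣ * (G b x * (G a (y ℤ.- + 1) + pow (q * q) ∣ y ∣ * G a y))
      ≈⟨ trans (*-congˡ (distribˡ _ _ _)) (distribˡ _ _ _) ⟩
    pow q ∣ e ∣ * (G b x * G a (y ℤ.- + 1)) + pow q ∣ e ∣ * (G b x * (pow (q * q) ∣ y ∣ * G a y))
      ≈⟨ +-cong (*-congˡ (*-comm _ _)) (*-congˡ (*-Props.x∙yz≈y∙zx _ _ _)) ⟩
    weighted q a b e (y ℤ.- + 1) x + pow q ∣ e ∣ * (pow (q * q) ∣ y ∣ * (G a y * G b x))
      ≈⟨ +-congˡ (pascal-weight-transfer q a b x y 0≤e 0≤e′ balanced) ⟩
    weighted q a b e (y ℤ.- + 1) x + pow q ∣ x ℤ.+ y ∣ * weighted q a b e′ y x ∎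
    where G = gauss (q * q)

  evenTerm : Carrier → ℕ → ℤ → ℤ → Carrier
  evenTerm q n k j = weighted q ⌊ n /2⌋ ⌈ n /2⌉ (+ 2 ℤ.* j ℤ.* j ℤ.- j) (k ℤ.- j) (k ℤ.+ j)

  -- ⌊ suc n /2⌋ and ⌈ suc n /2⌉ compute to ⌈ n /2⌉ and suc ⌊ n /2⌋, so term q (suc n) k j is
  -- literally the left-hand side of weighted-pascal.
  term-suc : ∀ q n k j → term q (suc n) k j
                           ≈ evenTerm q n k j + pow q ∣ + 2 ℤ.* k ℤ.+ + 1 ∣ * term q n k (+ 1 ℤ.- j)
  term-suc q n k j = begin
    term q (suc n) k j
      ≈⟨ weighted-pascal q a b x y (0≤2j²-j j) (0≤2j²-j (+ 1 ℤ.- j)) (exponents k j) ⟩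
    weighted q a b E (y ℤ.- + 1) x + pow q ∣ x ℤ.+ y ∣ * weighted q a b E′ y x
      ≡⟨ ≡.cong₂ (λ z w → weighted q a b E z x + pow q ∣ w ∣ * weighted q a b E′ y x)
                 (lower k j) (odd-indices-sum k j) ⟩
    evenTerm q n k j + pow q ∣ + 2 ℤ.* k ℤ.+ + 1 ∣ * weighted q a b E′ y x
      ≡⟨ ≡.cong (λ t → evenTerm q n k j + pow q ∣ + 2 ℤ.* k ℤ.+ + 1 ∣ * t)
                (≡.cong₂ (weighted q a b E′) (reflected k j) (reflected′ k j)) ⟩
    evenTerm q n k j + pow q ∣ + 2 ℤ.* k ℤ.+ + 1 ∣ * term q n k (+ 1 ℤ.- j) ∎
    where
    a = ⌊ n /2⌋
    b = ⌈ n /2⌉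
    x = k ℤ.+ j
    y = k ℤ.+ + 1 ℤ.- j
    E = + 2 ℤ.* j ℤ.* j ℤ.- j
    E′ = + 2 ℤ.* (+ 1 ℤ.- j) ℤ.* (+ 1 ℤ.- j) ℤ.- (+ 1 ℤ.- j)
    exponents : ∀ k j → (+ 2 ℤ.* j ℤ.* j ℤ.- j) ℤ.+ ((k ℤ.+ + 1 ℤ.- j) ℤ.+ (k ℤ.+ + 1 ℤ.- j))
                        ≡ ((k ℤ.+ j) ℤ.+ (k ℤ.+ + 1 ℤ.- j))
                            ℤ.+ (+ 2 ℤ.* (+ 1 ℤ.- j) ℤ.* (+ 1 ℤ.- j) ℤ.- (+ 1 ℤ.- j))
    exponents = solve-∀
    lower : ∀ k j → k ℤ.+ + 1 ℤ.- j ℤ.- + 1 ≡ k ℤ.- j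
    lower = solve-∀
    reflected : ∀ k j → k ℤ.+ + 1 ℤ.- j ≡ k ℤ.+ (+ 1 ℤ.- j)
    reflected = solve-∀
    reflected′ : ∀ k j → k ℤ.+ j ≡ k ℤ.+ + 1 ℤ.- (+ 1 ℤ.- j)
    reflected′ = solve-∀

  evenTerm-suc : ∀ q n k j → evenTerm q (suc n) k j
                               ≈ term q n (k ℤ.- + 1) j + pow q ∣ + 2 ℤ.* k ∣ * evenTerm q n k (ℤ.- j)
  evenTerm-suc q n k j = begin
    evenTerm q (suc n) k j
      ≈⟨ weighted-pascal q a b x y (0≤2j²-j j) (0≤2j²-j (ℤ.- j)) (exponents k j) ⟩
    weighted q a b E (y ℤ.- + 1) x + pow q ∣ x ℤ.+ y ∣ * weighted q a b E′ y x
      ≡⟨ ≡.cong₂ (λ z w → weighted q a b E z x + pow q ∣ w ∣ * weighted q a b E′ y x)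
                 (lower k j) (even-indices-sum k j) ⟩
    weighted q a b E (k ℤ.- + 1 ℤ.+ j) x + pow q ∣ + 2 ℤ.* k ∣ * weighted q a b E′ y x
      ≡⟨ ≡.cong₂ (λ z t → weighted q a b E (k ℤ.- + 1 ℤ.+ j) z + pow q ∣ + 2 ℤ.* k ∣ * t)
                 (upper k j) (≡.cong (λ z → weighted q a b E′ z x) (reflected k j)) ⟩
    term q n (k ℤ.- + 1) j + pow q ∣ + 2 ℤ.* k ∣ * evenTerm q n k (ℤ.- j) ∎
    where
    a = ⌊ n /2⌋
    b = ⌈ n /2⌉
    x = k ℤ.- j
    y = k ℤ.+ j
    E = + 2 ℤ.* j ℤ.* j ℤ.- j
    E′ = + 2 ℤ.* (ℤ.- j) ℤ.* (ℤ.- j) ℤ.- (ℤ.- j)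
    exponents : ∀ k j → (+ 2 ℤ.* j ℤ.* j ℤ.- j) ℤ.+ ((k ℤ.+ j) ℤ.+ (k ℤ.+ j))
                        ≡ ((k ℤ.- j) ℤ.+ (k ℤ.+ j)) ℤ.+ (+ 2 ℤ.* (ℤ.- j) ℤ.* (ℤ.- j) ℤ.- (ℤ.- j))
    exponents = solve-∀
    lower : ∀ k j → k ℤ.+ j ℤ.- + 1 ≡ k ℤ.- + 1 ℤ.+ j
    lower = solve-∀
    upper : ∀ k j → k ℤ.- j ≡ k ℤ.- + 1 ℤ.+ + 1 ℤ.- j
    upper = solve-∀
    reflected : ∀ k j → k ℤ.+ j ≡ k ℤ.- ℤ.- j
    reflected = solve-∀

  symSum : ℕ → (ℤ → Carrier) → Carrier
  symSum zero    f = f 0ℤ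
  symSum (suc N) f = f -[1+ N ] + (symSum N f + f +[1+ N ])

  symSum-cong : ∀ N {f g} → (∀ j → f j ≈ g j) → symSum N f ≈ symSum N g
  symSum-cong zero    f≈g = f≈g 0ℤ
  symSum-cong (suc N) f≈g = +-cong (f≈g _) (+-cong (symSum-cong N f≈g) (f≈g _))

  symSum-linear : ∀ N f g w → symSum N (λ j → f j + w * g j) ≈ symSum N f + w * symSum N g
  symSum-linear zero    f g w = refl
  symSum-linear (suc N) f g w = begin
    (f a + w * g a) + (symSum N (λ j → f j + w * g j) + (f b + w * g b))
      ≈⟨ +-congˡ (+-congʳ (symSum-linear N f g w)) ⟩
    (f a + w * g a) + ((symSum N f + w * symSum N g) + (f b + w * g b))
      ≈⟨ +-congˡ (+-Props.interchange _ _ _ _) ⟩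
    (f a + w * g a) + ((symSum N f + f b) + (w * symSum N g + w * g b))
      ≈⟨ +-Props.interchange _ _ _ _ ⟩
    (f a + (symSum N f + f b)) + (w * g a + (w * symSum N g + w * g b))
      ≈⟨ +-congˡ (trans (distribˡ w _ _) (+-congˡ (distribˡ w _ _))) ⟨
    (f a + (symSum N f + f b)) + w * (g a + (symSum N g + g b)) ∎
    where
    a = -[1+ N ]
    b = +[1+ N ]

  symSum-reflect : ∀ N f → symSum N (f ∘ ℤ.-_) ≈ symSum N f
  symSum-reflect zero    f = refl
  symSum-reflect (suc N) f =
    trans (+-congˡ (+-congʳ (symSum-reflect N f))) (+-Props.x∙yz≈z∙yx _ _ _)

  symSum-translate : ∀ N f → symSum N (λ j → f (+ 1 ℤ.+ j)) + f (ℤ.- + N) ≈ symSum N f + f +[1+ N ]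
  symSum-translate zero    f = +-comm _ _
  symSum-translate (suc N) f = begin
    (f (+ 1 ℤ.+ -[1+ N ]) + (symSum N g + f +[1+ suc N ])) + f -[1+ N ]
      ≡⟨ ≡.cong (λ i → (f i + (symSum N g + f +[1+ suc N ])) + f -[1+ N ]) (1+-[1+N]≡-N N) ⟩
    (f (ℤ.- + N) + (symSum N g + f +[1+ suc N ])) + f -[1+ N ]
      ≈⟨ trans (+-comm _ _) (+-congˡ (+-Props.x∙yz≈yx∙z _ _ _)) ⟩
    f -[1+ N ] + ((symSum N g + f (ℤ.- + N)) + f +[1+ suc N ])
      ≈⟨ +-congˡ (+-congʳ (symSum-translate N f)) ⟩
    f -[1+ N ] + ((symSum N f + f +[1+ N ]) + f +[1+ suc N ])
      ≈⟨ +-assoc _ _ _ ⟨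
    (f -[1+ N ] + (symSum N f + f +[1+ N ])) + f +[1+ suc N ] ∎
    where
    g = λ j → f (+ 1 ℤ.+ j)
    1+-[1+N]≡-N : ∀ N → + 1 ℤ.+ -[1+ N ] ≡ ℤ.- + N
    1+-[1+N]≡-N zero    = ≡.refl
    1+-[1+N]≡-N (suc N) = ≡.refl

  symSum-translate-vanishing : ∀ N f → f (ℤ.- + N) ≈ 0# → f +[1+ N ] ≈ 0# →
                               symSum N (λ j → f (+ 1 ℤ.+ j)) ≈ symSum N f
  symSum-translate-vanishing N f left right = begin
    symSum N (λ j → f (+ 1 ℤ.+ j))                ≈⟨ +-identityʳ _ ⟨
    symSum N (λ j → f (+ 1 ℤ.+ j)) + 0#           ≈⟨ +-congˡ left ⟨
    symSum N (λ j → f (+ 1 ℤ.+ j)) + f (ℤ.- + N)  ≈⟨ symSum-translate N f ⟩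
    symSum N f + f +[1+ N ]                       ≈⟨ +-congˡ right ⟩
    symSum N f + 0#                               ≈⟨ +-identityʳ _ ⟩
    symSum N f                                    ∎

  symSum-vanishing : ∀ N {f} → (∀ j → f j ≈ 0#) → symSum N f ≈ 0#
  symSum-vanishing zero    f≈0 = f≈0 0ℤ
  symSum-vanishing (suc N) f≈0 =
    trans (+-cong (f≈0 _) (+-cong (symSum-vanishing N f≈0) (f≈0 _)))
          (trans (+-identityˡ _) (+-identityˡ _))

  symSum-point : ∀ N {f} → (∀ j → j ≢ 0ℤ → f j ≈ 0#) → symSum N f ≈ f 0ℤ
  symSum-point zero    _   = refl
  symSum-point (suc N) f≈0 =
    trans (+-cong (f≈0 _ (λ ())) (+-cong (symSum-point N f≈0) (f≈0 _ (λ ()))))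
          (trans (+-identityˡ _) (+-identityʳ _))

  sumL-applyUpTo-suc : ∀ f L → sumL (applyUpTo f (suc L)) ≈ sumL (applyUpTo f L) + f L
  sumL-applyUpTo-suc f zero    = +-comm _ _
  sumL-applyUpTo-suc f (suc L) =
    trans (+-congˡ (sumL-applyUpTo-suc (f ∘ suc) L)) (sym (+-assoc _ _ _))

  sumL-centred : ∀ M f F → (∀ i → F i ≈ f (+ i ℤ.- + M)) →
                 sumL (applyUpTo F (suc (2 ℕ.* M))) ≈ symSum M f
  sumL-centred zero    f F F≈f = trans (+-identityʳ _) (F≈f 0)
  sumL-centred (suc M) f F F≈f = begin
    sumL (applyUpTo F (suc (2 ℕ.* suc M)))
      ≡⟨ ≡.cong (λ L → sumL (applyUpTo F (suc L))) (ℕP.*-suc 2 M) ⟩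
    F 0 + sumL (applyUpTo (F ∘ suc) (suc (suc (2 ℕ.* M))))
      ≈⟨ +-congˡ (sumL-applyUpTo-suc (F ∘ suc) (suc (2 ℕ.* M))) ⟩
    F 0 + (sumL (applyUpTo (F ∘ suc) (suc (2 ℕ.* M))) + F (suc (suc (2 ℕ.* M))))
      ≈⟨ +-cong (F≈f 0) (+-cong (sumL-centred M f (F ∘ suc) inner) last) ⟩
    f -[1+ M ] + (symSum M f + f +[1+ M ]) ∎
    where
    shift : ∀ x y → (+ 1 ℤ.+ x) ℤ.- (+ 1 ℤ.+ y) ≡ x ℤ.- y
    shift = solve-∀
    -- + (2 ℕ.* M) is definitionally + M ℤ.+ (+ M ℤ.+ + 0).
    top : ∀ x → (+ 1 ℤ.+ (+ 1 ℤ.+ (x ℤ.+ (x ℤ.+ + 0)))) ℤ.- (+ 1 ℤ.+ x) ≡ + 1 ℤ.+ x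
    top = solve-∀
    inner : ∀ i → F (suc i) ≈ f (+ i ℤ.- + M)
    inner i = trans (F≈f (suc i)) (reflexive (≡.cong f (shift (+ i) (+ M))))
    last : F (suc (suc (2 ℕ.* M))) ≈ f +[1+ M ]
    last = trans (F≈f _) (reflexive (≡.cong f (top (+ M))))

  sumL-window : ∀ M f → sumL (map f (map (λ i → + i ℤ.- + M) (upTo (suc (2 ℕ.* M))))) ≈ symSum M f
  sumL-window M f = begin
    sumL (map f (map centre (upTo L)))  ≡⟨ ≡.cong (sumL ∘ map f) (map-upTo centre L) ⟩
    sumL (map f (applyUpTo centre L))   ≡⟨ ≡.cong sumL (map-applyUpTo centre f L) ⟩
    sumL (applyUpTo (f ∘ centre) L)     ≈⟨ sumL-centred M f (f ∘ centre) (λ _ → refl) ⟩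
    symSum M f                          ∎
    where
    L = suc (2 ℕ.* M)
    centre = λ i → + i ℤ.- + M

  term-outside : ∀ q n k j → n ℕ.+ ∣ k ∣ ℕ.< ∣ j ∣ → term q n k j ≈ 0#
  term-outside q n k j n+∣k∣<∣j∣ =
    *-vanishesʳ (trans (*-congʳ (gauss-outside (q * q) ⌊ n /2⌋ (k ℤ.+ j) ⌊n/2⌋<∣k+j∣)) (zeroˡ _))
    where
    k+j-k≡j : ∀ k j → k ℤ.+ j ℤ.- k ≡ j
    k+j-k≡j = solve-∀
    triangle : ∣ j ∣ ℕ.≤ ∣ k ℤ.+ j ∣ ℕ.+ ∣ k ∣
    triangle = ≡.subst (λ i → ∣ i ∣ ℕ.≤ ∣ k ℤ.+ j ∣ ℕ.+ ∣ k ∣) (k+j-k≡j k j)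
                       (ℤP.∣i-j∣≤∣i∣+∣j∣ (k ℤ.+ j) k)
    ⌊n/2⌋<∣k+j∣ : ⌊ n /2⌋ ℕ.< ∣ k ℤ.+ j ∣
    ⌊n/2⌋<∣k+j∣ = ℕP.≤-<-trans (ℕP.⌊n/2⌋≤n n)
                    (ℕP.+-cancelʳ-< ∣ k ∣ n _ (ℕP.<-≤-trans n+∣k∣<∣j∣ triangle))

  symSum-term-base : ∀ q k M → symSum M (term q 0 k) ≈ gauss q 0 (+ 2 ℤ.* k ℤ.+ + 1)
  symSum-term-base q k M = trans (symSum-vanishing M term≈0) (sym gauss≈0)
    where
    term≈0 : ∀ j → term q 0 k j ≈ 0#
    term≈0 j = weighted₀-vanishes q (+ 2 ℤ.* j ℤ.* j ℤ.- j) (k ℤ.+ j) (k ℤ.+ + 1 ℤ.- j)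
      λ (x≡0 , y≡0) → 2k+1≢0 k (≡.trans (≡.sym (odd-indices-sum k j)) (≡.cong₂ ℤ._+_ x≡0 y≡0))
    gauss≈0 : gauss q 0 (+ 2 ℤ.* k ℤ.+ + 1) ≈ 0#
    gauss≈0 = gauss-outside q 0 (+ 2 ℤ.* k ℤ.+ + 1) (ℕP.n≢0⇒n>0 (2k+1≢0 k ∘ ℤP.∣i∣≡0⇒i≡0))

  symSum-evenTerm₀-vanishing : ∀ q k M → + 2 ℤ.* k ≢ 0ℤ → symSum M (evenTerm q 0 k) ≈ 0#
  symSum-evenTerm₀-vanishing q k M 2k≢0 = symSum-vanishing M λ j →
    weighted₀-vanishes q (+ 2 ℤ.* j ℤ.* j ℤ.- j) (k ℤ.- j) (k ℤ.+ j) λ (x≡0 , y≡0) →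
      2k≢0 (≡.trans (≡.sym (even-indices-sum k j)) (≡.cong₂ ℤ._+_ x≡0 y≡0))

  symSum-evenTerm-base : ∀ q k M → symSum M (evenTerm q 0 k) ≈ gauss q 0 (+ 2 ℤ.* k)
  symSum-evenTerm-base q (+ zero) M =
    trans (symSum-point M off-centre) (trans (*-identityˡ _) (*-identityˡ _))
    where
    off-centre : ∀ j → j ≢ 0ℤ → evenTerm q 0 0ℤ j ≈ 0#
    off-centre j j≢0 = weighted₀-vanishes q (+ 2 ℤ.* j ℤ.* j ℤ.- j) (0ℤ ℤ.- j) (0ℤ ℤ.+ j)
      λ (_ , y≡0) → j≢0 (≡.trans (≡.sym (ℤP.+-identityˡ j)) y≡0)
  symSum-evenTerm-base q k@(+[1+ _ ]) M = symSum-evenTerm₀-vanishing q k M λ ()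
  symSum-evenTerm-base q k@(-[1+ _ ]) M = symSum-evenTerm₀-vanishing q k M λ ()

  symSum-term     : ∀ q n k M → n ℕ.+ ∣ k ∣ ℕ.< M →
                    symSum M (term q n k) ≈ gauss q n (+ 2 ℤ.* k ℤ.+ + 1)
  symSum-evenTerm : ∀ q n k M → n ℕ.+ ∣ k ∣ ℕ.< M →
                    symSum M (evenTerm q n k) ≈ gauss q n (+ 2 ℤ.* k)

  symSum-term q zero    k M _     = symSum-term-base q k M
  symSum-term q (suc n) k M bound = begin
    symSum M (term q (suc n) k)
      ≈⟨ symSum-cong M (term-suc q n k) ⟩
    symSum M (λ j → evenTerm q n k j + w * term q n k (+ 1 ℤ.- j))
      ≈⟨ symSum-linear M _ _ w ⟩
    symSum M (evenTerm q n k) + w * symSum M (λ j → term q n k (+ 1 ℤ.- j))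
      ≈⟨ +-congˡ (*-congˡ (trans (symSum-reflect M _) (symSum-translate-vanishing M _ left right))) ⟩
    symSum M (evenTerm q n k) + w * symSum M (term q n k)
      ≈⟨ +-cong (symSum-evenTerm q n k M bound′) (*-congˡ (symSum-term q n k M bound′)) ⟩
    gauss q n (+ 2 ℤ.* k) + w * gauss q n (+ 2 ℤ.* k ℤ.+ + 1)
      ≡⟨ ≡.cong (λ i → gauss q n i + w * gauss q n (+ 2 ℤ.* k ℤ.+ + 1)) (2k+1-1≡2k k) ⟨
    gauss q n (+ 2 ℤ.* k ℤ.+ + 1 ℤ.- + 1) + w * gauss q n (+ 2 ℤ.* k ℤ.+ + 1)
      ≈⟨ gauss-pascal q n (+ 2 ℤ.* k ℤ.+ + 1) ⟨
    gauss q (suc n) (+ 2 ℤ.* k ℤ.+ + 1) ∎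
    where
    w = pow q ∣ + 2 ℤ.* k ℤ.+ + 1 ∣
    bound′ : n ℕ.+ ∣ k ∣ ℕ.< M
    bound′ = ℕP.<⇒≤ bound
    left : term q n k (ℤ.- + M) ≈ 0#
    left = term-outside q n k _ (≡.subst (n ℕ.+ ∣ k ∣ ℕ.<_) (≡.sym (ℤP.∣-i∣≡∣i∣ (+ M))) bound′)
    right : term q n k +[1+ M ] ≈ 0#
    right = term-outside q n k _ (ℕP.m<n⇒m<1+n bound′)
    2k+1-1≡2k : ∀ k → + 2 ℤ.* k ℤ.+ + 1 ℤ.- + 1 ≡ + 2 ℤ.* k
    2k+1-1≡2k = solve-∀

  symSum-evenTerm q zero    k M _     = symSum-evenTerm-base q k M
  symSum-evenTerm q (suc n) k M bound = begin
    symSum M (evenTerm q (suc n) k)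
      ≈⟨ symSum-cong M (evenTerm-suc q n k) ⟩
    symSum M (λ j → term q n (k ℤ.- + 1) j + w * evenTerm q n k (ℤ.- j))
      ≈⟨ symSum-linear M _ _ w ⟩
    symSum M (term q n (k ℤ.- + 1)) + w * symSum M (evenTerm q n k ∘ ℤ.-_)
      ≈⟨ +-cong (symSum-term q n (k ℤ.- + 1) M bound-pred)
                (*-congˡ (trans (symSum-reflect M _) (symSum-evenTerm q n k M (ℕP.<⇒≤ bound)))) ⟩
    gauss q n (+ 2 ℤ.* (k ℤ.- + 1) ℤ.+ + 1) + w * gauss q n (+ 2 ℤ.* k)
      ≡⟨ ≡.cong (λ i → gauss q n i + w * gauss q n (+ 2 ℤ.* k)) (2[k-1]+1≡2k-1 k) ⟩
    gauss q n (+ 2 ℤ.* k ℤ.- + 1) + w * gauss q n (+ 2 ℤ.* k)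
      ≈⟨ gauss-pascal q n (+ 2 ℤ.* k) ⟨
    gauss q (suc n) (+ 2 ℤ.* k) ∎
    where
    w = pow q ∣ + 2 ℤ.* k ∣
    bound-pred : n ℕ.+ ∣ k ℤ.- + 1 ∣ ℕ.< M
    bound-pred = ℕP.≤-<-trans (ℕP.≤-trans (ℕP.+-monoʳ-≤ n (ℤP.∣i-j∣≤∣i∣+∣j∣ k (+ 1)))
                                          (ℕP.≤-reflexive (≡.trans (≡.cong (n ℕ.+_) (ℕP.+-comm ∣ k ∣ 1))
                                                                   (ℕP.+-suc n ∣ k ∣))))
                              bound
    2[k-1]+1≡2k-1 : ∀ k → + 2 ℤ.* (k ℤ.- + 1) ℤ.+ + 1 ≡ + 2 ℤ.* k ℤ.- + 1
    2[k-1]+1≡2k-1 = solve-∀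

open import Data.Integer using (_+_; _*_)

mainTheorem6 : ∀ {c ℓ : Level} (R : CommutativeRing c ℓ) (q : CommutativeRing.Carrier R)
                 (n : ℕ) (k : ℤ) →
                 CommutativeRing._≈_ R (Gauss.h R q n k) (Gauss.gauss R q n (+ 2 * k + + 1))
mainTheorem6 R q n k =
  CommutativeRing.trans R (sumL-window R M (Gauss.term R q n k))
                          (symSum-term R q n k M (ℕP.m<m+n (n ℕ.+ ∣ k ∣) ℕ.z<s))
  where M = n ℕ.+ ∣ k ∣ ℕ.+ 1
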